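{- Let $n\ge2$. There is a bijection between (1) skeletal quiddity sequences $q=(a_1,\dots,a_p)$ with $1\le p<n$ and $n=p+\sum_{k=1}^p(a_k-2)$, and (2) skeletal triangulations of annuli $C_{m,n-m}$ with $1\le m<n$.
   Context: Friezes: given positive integers $(a_i)_{i\in\mathbb{Z}}$, define $a_{i,j}$ ($j\ge i-2$) by $a_{i,i-2}=0$, $a_{i,i-1}=1$, $a_{i,i}=a_i$ and $a_{i,j}a_{i+1,j+1}-a_{i,j+1}a_{i+1,j}=1$; this is an infinite frieze if all $a_{i,j}$ with $j\ge i$ are positive integers, periodic with quiddity sequence $(a_1,\dots,a_p)$ if $a_{i+p}=a_i$; quiddity sequences are considered up to cyclic rotation. A quiddity sequence is skeletal if no entry equals $1$ and it is not $(2,\dots,2)$. Annuli: $C_{m,n}$ is an annulus with $m$ marked points on one boundary component and $n$ on the other. An arc is a homotopy class of curves between marked points with a representative without self-intersections, meeting the boundary only at its endpoints, and not contractible into the boundary; a triangulation is a maximal collection of pairwise non-crossing arcs (only such finite arcs allowed). An arc is peripheral if its endpoints lie on the same boundary component and bridging otherwise. The flip of an arc replaces it by the other diagonal of the quadrilateral formed by its two incident triangles; a bounding arc is a peripheral arc whose flip is bridging. The skeletal triangulation $\mathcal{T}^s$ of $\mathcal{T}$ is obtained by cutting along all bounding arcs and removing the triangulated polygons cut off by them; a triangulation is skeletal if $\mathcal{T}=\mathcal{T}^s$, equivalently all its arcs are bridging. -}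

module Defs where

open import Data.Nat as ℕ using (ℕ; zero; suc)
open import Data.Integer as ℤ using (ℤ; +_)
open import Data.List using (List; []; _∷_; _++_; [_]; length; map; foldr)
open import Data.List.Relation.Unary.All using (All)
open import Data.List.Relation.Unary.Any using (Any)
open import Data.List.Membership.Propositional using (_∈_)
open import Data.Product using (Σ; ∃; ∃-syntax; _×_; _,_)
open import Data.Sum using (_⊎_)
open import Data.Unit using (⊤)
open import Data.Empty using (⊥)
open import Relation.Nullary using (¬_)
open import Relation.Binary.PropositionalEquality using (_≡_)

-- An array  A i d  encodes the frieze entry  a_{i, i+d-2}  (d : ℕ, so j ≥ i-2).
-- (a_i) is an infinite frieze if the array defined by
--   a_{i,i-2} = 0, a_{i,i-1} = 1, a_{i,i} = a_i,
--   a_{i,j} a_{i+1,j+1} - a_{i,j+1} a_{i+1,j} = 1   (j ≥ i-1)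
-- consists of positive integers for j ≥ i (i.e. d ≥ 2).
-- (The diamond rule determines the array uniquely, so "exists" = "the".)
IsInfiniteFrieze : (ℤ → ℕ) → Set
IsInfiniteFrieze a =
  (∀ i → 0 ℕ.< a i) ×
  Σ (ℤ → ℕ → ℤ) λ A →
    (∀ i → A i 0 ≡ + 0) ×
    (∀ i → A i 1 ≡ + 1) ×
    (∀ i → A i 2 ≡ + a i) ×
    (∀ i e → A i (suc e) ℤ.* A (ℤ.suc i) (suc e)
               ℤ.- A i (suc (suc e)) ℤ.* A (ℤ.suc i) e ≡ + 1) ×
    (∀ i d → + 0 ℤ.< A i (suc (suc d)))

nth : List ℕ → ℕ → ℕ
nth []       _       = 0
nth (x ∷ xs) zero    = x
nth (x ∷ xs) (suc k) = nth xs k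

-- periodic extension of (a_1,...,a_p) to ℤ : a_i = a_{i mod p}
-- (index 1 ↦ first entry; for p = 0 we return 0, irrelevant since p ≥ 1 is required)
periodicExt : List ℕ → ℤ → ℕ
periodicExt []         i = 0
periodicExt q@(_ ∷ xs) i = nth q ((i ℤ.- + 1) ℤ.%ℕ suc (length xs))

IsQuiddity : List ℕ → Set
IsQuiddity q = (1 ℕ.≤ length q) × IsInfiniteFrieze (periodicExt q)

AllTwo : List ℕ → Set
AllTwo q = All (λ a → a ≡ 2) q

IsSkeletalQuiddity : List ℕ → Set
IsSkeletalQuiddity q = IsQuiddity q × All (λ a → ¬ (a ≡ 1)) q × ¬ AllTwo q

rotate : List ℕ → ℕ → List ℕ
rotate []       _       = []
rotate (x ∷ xs) zero    = x ∷ xs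
rotate (x ∷ xs) (suc r) = rotate (xs ++ [ x ]) r

_~rot_ : List ℕ → List ℕ → Set
q ~rot q' = ∃[ r ] rotate q r ≡ q'

sumℤ : List ℤ → ℤ
sumℤ = foldr ℤ._+_ (+ 0)

QuidSet : ℕ → Set
QuidSet n = Σ (List ℕ) λ q →
  IsSkeletalQuiddity q × (1 ℕ.≤ length q) × (length q ℕ.< n) ×
  (+ n ≡ + length q ℤ.+ sumℤ (map (λ a → + a ℤ.- + 2) q))

_≈Q_ : ∀ {n} → QuidSet n → QuidSet n → Set
(q , _) ≈Q (q' , _) = q ~rot q'

-- Annuli C_{m,k}: combinatorial model via the universal cover (a strip).
-- Outer marked points lift to i ∈ ℤ (point i mod m), inner ones to j ∈ ℤ
-- (point j mod k); the deck transformation is (i , j) ↦ (i + m , j + k).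
-- An arc (homotopy class) is an orbit of lifts under the deck group.

data Arc : Set where
  bridge : ℤ → ℤ → Arc   -- bridging arc from outer lift i to inner lift j
  outerP : ℤ → ℤ → Arc   -- peripheral arc on the outer boundary, lift from a to b (a < b)
  innerP : ℤ → ℤ → Arc   -- peripheral arc on the inner boundary, lift from c to d (c < d)

-- valid (simple, non-contractible-into-boundary) arcs of C_{m,k}:
-- peripheral lifts need b - a ≥ 2 (not a boundary segment) and b - a ≤ m (no self-crossing)
IsArc : ℕ → ℕ → Arc → Set
IsArc m k (bridge i j) = ⊤
IsArc m k (outerP a b) = (a ℤ.+ + 2 ℤ.≤ b) × (b ℤ.≤ a ℤ.+ + m)
IsArc m k (innerP c d) = (c ℤ.+ + 2 ℤ.≤ d) × (d ℤ.≤ c ℤ.+ + k)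

IsBridging : Arc → Set
IsBridging (bridge _ _) = ⊤
IsBridging (outerP _ _) = ⊥
IsBridging (innerP _ _) = ⊥

shift : ℤ → ℤ → Arc → Arc
shift s t (bridge i j) = bridge (i ℤ.+ s) (j ℤ.+ t)
shift s t (outerP a b) = outerP (a ℤ.+ s) (b ℤ.+ s)
shift s t (innerP c d) = innerP (c ℤ.+ t) (d ℤ.+ t)

deck : ℕ → ℕ → ℤ → Arc → Arc
deck m k r = shift (r ℤ.* + m) (r ℤ.* + k)

SameArc : ℕ → ℕ → Arc → Arc → Set
SameArc m k γ δ = ∃[ r ] deck m k r γ ≡ δ

_<_<_ : ℤ → ℤ → ℤ → Set
x < y < z = (x ℤ.< y) × (y ℤ.< z)

LiftCross : Arc → Arc → Set
LiftCross (bridge i j) (bridge i' j') = ((i ℤ.< i') × (j' ℤ.< j)) ⊎ ((i' ℤ.< i) × (j ℤ.< j'))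
LiftCross (bridge i j) (outerP a b)   = a < i < b
LiftCross (bridge i j) (innerP c d)   = c < j < d
LiftCross (outerP a b) (bridge i j)   = a < i < b
LiftCross (outerP a b) (outerP c d)   = ((a ℤ.< c) × (c ℤ.< b) × (b ℤ.< d)) ⊎ ((c ℤ.< a) × (a ℤ.< d) × (d ℤ.< b))
LiftCross (outerP a b) (innerP c d)   = ⊥
LiftCross (innerP c d) (bridge i j)   = c < j < d
LiftCross (innerP c d) (outerP a b)   = ⊥
LiftCross (innerP a b) (innerP c d)   = ((a ℤ.< c) × (c ℤ.< b) × (b ℤ.< d)) ⊎ ((c ℤ.< a) × (a ℤ.< d) × (d ℤ.< b))

Cross : ℕ → ℕ → Arc → Arc → Set
Cross m k γ δ = ∃[ r ] LiftCross γ (deck m k r δ)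

IsTriangulation : ℕ → ℕ → List Arc → Set
IsTriangulation m k T =
  All (IsArc m k) T ×
  (∀ {γ δ} → γ ∈ T → δ ∈ T → ¬ Cross m k γ δ) ×
  (∀ γ → IsArc m k γ → (∀ {δ} → δ ∈ T → ¬ Cross m k γ δ) → Any (SameArc m k γ) T)

IsSkeletalTriangulation : ℕ → ℕ → List Arc → Set
IsSkeletalTriangulation m k T = IsTriangulation m k T × All IsBridging T

-- triangulations equivalent under an orientation-preserving homeomorphism of
-- C_{m,k} fixing each boundary component (rotations of the boundaries, Dehn twists)
_≅[_,_]_ : List Arc → ℕ → ℕ → List Arc → Set
T ≅[ m , k ] T' = ∃[ s ] ∃[ t ]
  (∀ {γ} → γ ∈ T  → Any (SameArc m k (shift s t γ)) T') ×
  (∀ {δ} → δ ∈ T' → Any (λ γ → SameArc m k (shift s t γ) δ) T)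

TriSet : ℕ → Set
TriSet n = Σ ℕ λ m → (1 ℕ.≤ m) × (m ℕ.< n) ×
  Σ (List Arc) (IsSkeletalTriangulation m (n ℕ.∸ m))

_≈T_ : ∀ {n} → TriSet n → TriSet n → Set
_≈T_ {n} (m , _ , _ , T , _) (m' , _ , _ , T' , _) = (m ≡ m') × (T ≅[ m , n ℕ.∸ m ] T')

-- a bijection between the quotients QuidSet/≈Q and TriSet/≈T, presented by a
-- representative-level map that is well defined, injective and surjective
BijectionUpTo : (A : Set) → (A → A → Set) → (B : Set) → (B → B → Set) → Set
BijectionUpTo A _≈A_ B _≈B_ = Σ (A → B) λ f →
  (∀ x y → x ≈A y → f x ≈B f y) ×
  (∀ x y → f x ≈B f y → x ≈A y) ×
  (∀ z → ∃[ x ] f x ≈B z)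

-- Lift a skeletal triangulation of C_{m,k} to the universal cover, the strip with outer lifts
-- x ∈ ℤ and inner lifts y ∈ ℤ. Its lifts form a maximal family of pairwise non-crossing bridges
-- (x, y), invariant under the deck transformation (x, y) ↦ (x + m, y + k). Every such family is
-- a staircase: outer lift x is joined exactly to the inner lifts J x ≤ y ≤ J (x + 1), for a
-- monotone J with J (x + m) = J x + k. The staircase is determined by the increments
-- e_i = J (i + 1) - J i, a sequence of m naturals with sum k, and a rotation of the annulus
-- rotates this sequence cyclically. Setting a_i = e_i + 2 gives the sequences with all entries
-- at least 2, not all equal to 2, and with p + Σ (a_i - 2) = n. These are exactly the skeletal
-- quiddity sequences: for entries at least 2 every row of the frieze, a sequence of continuants,
-- is strictly increasing and hence positive.
module Submission where

open import Algebra.Bundles using (AbelianGroup)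
open import Data.Empty using (⊥-elim)
open import Data.Integer as ℤ
  using (ℤ; +_; _+_; _*_; _-_; -_; _≤_; _<_; 0ℤ; 1ℤ; -1ℤ; _%ℕ_; _/ℕ_; +≤+; +<+)
open import Data.Integer.DivMod using (n%ℕd<d; a≡a%ℕn+[a/ℕn]*n)
import Data.Integer.Properties as ℤP
open import Data.Integer.Solver using (module +-*-Solver)
open import Data.List using (List; []; _∷_; _++_; [_]; length; map; take; filter; cartesianProduct; upTo)
open import Data.List.Membership.Propositional using (_∈_; find; lose)
import Data.List.Membership.Propositional.Properties as ∈
import Data.List.Properties as List
open import Data.List.Relation.Binary.Permutation.Propositional using (_↭_; ↭-refl; ↭-sym; ↭-trans)
open import Data.List.Relation.Binary.Permutation.Propositional.Properties
  using (∷↭∷ʳ; ↭-length; All-resp-↭)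
open import Data.List.Relation.Unary.All using (All; []; _∷_)
import Data.List.Relation.Unary.All as All
open import Data.List.Relation.Unary.Any using (Any; here; there)
import Data.List.Relation.Unary.Any as Any
open import Data.Nat as ℕ using (ℕ; zero; suc; _∸_; NonZero; z≤n; s≤s)
open import Data.Nat.DivMod using (m<n⇒m%n≡m)
open import Data.Nat.ListAction using (sum)
open import Data.Nat.ListAction.Properties using (sum-↭)
import Data.Nat.Properties as ℕP
open import Data.Product using (∃₂; ∃-syntax; _×_; _,_; proj₁; proj₂)
open import Data.Sum using (inj₁; inj₂)
open import Data.Unit using (tt)
open import Function using (_∘_; _⇔_; mk⇔; Equivalence; case_of_)
open import Function.Properties.Equivalence using () renaming (trans to ⇔-trans; sym to ⇔-sym)
open import Relation.Binary using (tri<; tri≈; tri>)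
open import Relation.Binary.PropositionalEquality
  using (_≡_; _≢_; _≗_; refl; sym; trans; cong; cong₂; subst; subst₂; module ≡-Reasoning)
open import Relation.Nullary using (¬_; Dec; yes; no)
open import Relation.Nullary.Decidable using (map′; _×-dec_)
open import Relation.Unary using (Decidable)
open import Algebra.Properties.Group (AbelianGroup.group ℤP.+-0-abelianGroup)
  using (//-rightDividesˡ; //-rightDividesʳ; ∙-cancelˡ; ∙-cancelʳ)

open import Defs

open +-*-Solver using (solve; _:+_; _:*_; _:-_; :-_; _:=_; con)

private
  variable
    a b x y : ℤ

i-j+j≡i : ∀ i j → i - j + j ≡ i
i-j+j≡i i j = //-rightDividesˡ j i

i+j-j≡i : ∀ i j → i + j - j ≡ i
i+j-j≡i i j = //-rightDividesʳ j i

+-cancelˡ-≡ : ∀ c → c + a ≡ c + b → a ≡ b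
+-cancelˡ-≡ {a} {b} c = ∙-cancelˡ c a b

+-cancelʳ-≡ : ∀ c → a + c ≡ b + c → a ≡ b
+-cancelʳ-≡ {a} {b} c = ∙-cancelʳ c a b

+-cancelʳ-≤ : ∀ c → a + c ≤ b + c → a ≤ b
+-cancelʳ-≤ {a} {b} c le = subst₂ _≤_ (i+j-j≡i a c) (i+j-j≡i b c) (ℤP.+-monoˡ-≤ (- c) le)

i<suc[i] : ∀ i → i < ℤ.suc i
i<suc[i] i = ℤP.suc[i]≤j⇒i<j ℤP.≤-refl

pred[i]<i : ∀ i → ℤ.pred i < i
pred[i]<i i = ℤP.i≤pred[j]⇒i<j ℤP.≤-refl

i<suc[j]⇒i≤j : x < ℤ.suc y → x ≤ y
i<suc[j]⇒i≤j {x} {y} lt = subst (x ≤_) (ℤP.pred-suc y) (ℤP.i<j⇒i≤pred[j] lt)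

pred[i]<j⇒i≤j : ℤ.pred x < y → x ≤ y
pred[i]<j⇒i≤j {x} lt = subst (_≤ _) (ℤP.suc-pred x) (ℤP.i<j⇒suc[i]≤j lt)

i<j⇒0<j-i : a < b → 0ℤ < b - a
i<j⇒0<j-i {a} {b} a<b = subst (_< b - a) (ℤP.+-inverseʳ a) (ℤP.+-monoˡ-< (- a) a<b)

i+2≤j⇒suc[i]<j : a + + 2 ≤ b → ℤ.suc a < b
i+2≤j⇒suc[i]<j {a} {b} le =
  ℤP.suc[i]≤j⇒i<j (subst (_≤ b) (solve 1 (λ a → a :+ con (+ 2) := con 1ℤ :+ (con 1ℤ :+ a)) refl a) le)

suc-+ : ∀ x y → ℤ.suc x + y ≡ ℤ.suc (x + y)
suc-+ x y = ℤP.+-assoc 1ℤ x y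

≤⇒+ : x ≤ y → ∃[ n ] y ≡ x + + n
≤⇒+ {x} {y} x≤y = ℤ.∣ y - x ∣ , sym (begin
  x + + ℤ.∣ y - x ∣  ≡⟨ cong (λ w → x + w) (ℤP.0≤i⇒+∣i∣≡i (ℤP.i≤j⇒0≤j-i x≤y)) ⟩
  x + (y - x)       ≡⟨ ℤP.+-comm x (y - x) ⟩
  y - x + x         ≡⟨ i-j+j≡i y x ⟩
  y                 ∎)
  where open ≡-Reasoning

stepwise-mono : (f : ℤ → ℤ) → (∀ x → f x ≤ f (ℤ.suc x)) → ∀ {x y} → x ≤ y → f x ≤ f y
stepwise-mono f f-step {x} x≤y with ≤⇒+ x≤y
... | n , refl = go n x
  where
  go : ∀ n x → f x ≤ f (x + + n)
  go zero    x = ℤP.≤-reflexive (cong f (sym (ℤP.+-identityʳ x)))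
  go (suc n) x = ℤP.≤-trans (f-step x) (subst (λ w → f (ℤ.suc x) ≤ f w)
    (solve 2 (λ x n → (con 1ℤ :+ x) :+ n := x :+ (con 1ℤ :+ n)) refl x (+ n)) (go n (ℤ.suc x)))

module _ (m : ℕ) .{{_ : NonZero m}} where

  private
    <-by-quotient : ∀ {i i′ R R′} → i ℕ.< m → R < R′ → + i + R * + m < + i′ + R′ * + m
    <-by-quotient {i} {i′} {R} {R′} i<m R<R′ = begin-strict
      + i + R * + m    <⟨ ℤP.+-monoˡ-< (R * + m) (+<+ i<m) ⟩
      + m + R * + m    ≡⟨ solve 2 (λ m R → m :+ R :* m := (con 1ℤ :+ R) :* m) refl (+ m) R ⟩
      ℤ.suc R * + m    ≤⟨ ℤP.*-monoʳ-≤-nonNeg (+ m) (ℤP.i<j⇒suc[i]≤j R<R′) ⟩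
      R′ * + m         ≤⟨ ℤP.i≤j+i (R′ * + m) (+ i′) ⟩
      + i′ + R′ * + m  ∎
      where open ℤP.≤-Reasoning

  divMod-unique : ∀ {i i′ R R′} → i ℕ.< m → i′ ℕ.< m →
                  + i + R * + m ≡ + i′ + R′ * + m → i ≡ i′ × R ≡ R′
  divMod-unique {i} {i′} {R} {R′} i<m i′<m eq with ℤP.<-cmp R R′
  ... | tri< R<R′ _ _ = ⊥-elim (ℤP.<-irrefl eq (<-by-quotient i<m R<R′))
  ... | tri> _ _ R′<R = ⊥-elim (ℤP.<-irrefl (sym eq) (<-by-quotient i′<m R′<R))
  ... | tri≈ _ refl _ = ℤP.+-injective (+-cancelʳ-≡ (R * + m) eq) , refl

  %ℕ-/ℕ-unique : ∀ {i R} x → i ℕ.< m → x ≡ + i + R * + m → x %ℕ m ≡ i × x /ℕ m ≡ R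
  %ℕ-/ℕ-unique x i<m refl = divMod-unique (n%ℕd<d x m) i<m (sym (a≡a%ℕn+[a/ℕn]*n x m))

  deck-offset-unique : ∀ x r → (x + r * + m - x) /ℕ m ≡ r
  deck-offset-unique x r = proj₂ (%ℕ-/ℕ-unique (x + r * + m - x) (ℕ.>-nonZero⁻¹ m)
    (solve 2 (λ x t → x :+ t :- x := con 0ℤ :+ t) refl x (r * + m)))

least-witness : ∀ {Q : ℕ → Set} → Decidable Q → ∀ {n} → Q n →
                ∃[ j ] Q j × (∀ {i} → i ℕ.< j → ¬ Q i)
least-witness Q? {zero}  q = 0 , q , λ ()
least-witness Q? {suc n} q with Q? 0
... | yes q₀ = 0 , q₀ , λ ()
... | no ¬q₀ with least-witness (Q? ∘ suc) q
...   | j , qj , below = suc j , qj , λ { {zero} _ → ¬q₀ ; {suc i} i<j → below (ℕ.s≤s⁻¹ i<j) }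

last-before-failure : ∀ {Q : ℕ → Set} → Decidable Q → Q 0 → ∀ n → ¬ Q n →
                      ∃[ e ] Q e × ¬ Q (suc e)
last-before-failure Q? q₀ zero    ¬q = ⊥-elim (¬q q₀)
last-before-failure Q? q₀ (suc n) ¬q with Q? n
... | yes qn  = n , qn , ¬q
... | no  ¬qn = last-before-failure Q? q₀ n ¬qn

prefixSum : List ℕ → ℕ → ℕ
prefixSum L i = sum (take i L)

prefixSum-mono : ∀ L {i j} → i ℕ.≤ j → prefixSum L i ℕ.≤ prefixSum L j
prefixSum-mono L       {zero}  _         = z≤n
prefixSum-mono []      {suc i} _         = z≤n
prefixSum-mono (e ∷ L) {suc i} (s≤s i≤j) = ℕP.+-monoʳ-≤ e (prefixSum-mono L i≤j)

prefixSum-length : ∀ L → prefixSum L (length L) ≡ sum L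
prefixSum-length L = cong sum (List.take-all (length L) L ℕP.≤-refl)

prefixSum-++ : ∀ xs ys {i} → i ℕ.≤ length xs → prefixSum (xs ++ ys) i ≡ prefixSum xs i
prefixSum-++ xs       ys {zero}  _         = refl
prefixSum-++ (x ∷ xs) ys {suc i} (s≤s i≤n) = cong (x ℕ.+_) (prefixSum-++ xs ys i≤n)

prefixSum-injective : ∀ A B → length A ≡ length B →
                      (∀ i → i ℕ.≤ length A → prefixSum A i ≡ prefixSum B i) → A ≡ B
prefixSum-injective []      []      _   _  = refl
prefixSum-injective (a ∷ A) (b ∷ B) len eq = cong₂ _∷_ a≡b
  (prefixSum-injective A B (ℕP.suc-injective len) λ i i≤n →
    ℕP.+-cancelˡ-≡ a _ _ (trans (eq (suc i) (s≤s i≤n)) (cong (ℕ._+ prefixSum B i) (sym a≡b))))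
  where
  a≡b : a ≡ b
  a≡b = trans (sym (ℕP.+-identityʳ a)) (trans (eq 1 (s≤s z≤n)) (ℕP.+-identityʳ b))

rotate-↭ : ∀ L r → rotate L r ↭ L
rotate-↭ []      r       = ↭-refl
rotate-↭ (x ∷ L) zero    = ↭-refl
rotate-↭ (x ∷ L) (suc r) = ↭-trans (rotate-↭ (L ++ [ x ]) r) (↭-sym (∷↭∷ʳ x L))

rotate-map : ∀ (f : ℕ → ℕ) L r → map f (rotate L r) ≡ rotate (map f L) r
rotate-map f []      r       = refl
rotate-map f (x ∷ L) zero    = refl
rotate-map f (x ∷ L) (suc r) =
  trans (rotate-map f (L ++ [ x ]) r) (cong (λ L′ → rotate L′ r) (List.map-++ f L [ x ]))

-- Staircases

record Step (J : ℤ → ℤ) (x y : ℤ) : Set where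
  constructor step
  field
    lower : J x ≤ y
    upper : y ≤ J (ℤ.suc x)

Step-translate : ∀ {G J : ℤ → ℤ} u v → (∀ z → G z + v ≡ J (z + u)) →
                 ∀ {x y} → Step G x y ⇔ Step J (x + u) (y + v)
Step-translate {G} {J} u v G≡J {x} {y} = mk⇔
  (λ (step lo hi) → step (subst (_≤ y + v) (G≡J x) (ℤP.+-monoˡ-≤ v lo))
                         (subst (y + v ≤_) G[suc]≡ (ℤP.+-monoˡ-≤ v hi)))
  (λ (step lo hi) → step (+-cancelʳ-≤ v (subst (_≤ y + v) (sym (G≡J x)) lo))
                         (+-cancelʳ-≤ v (subst (y + v ≤_) (sym G[suc]≡) hi)))
  where
  G[suc]≡ : G (ℤ.suc x) + v ≡ J (ℤ.suc (x + u))
  G[suc]≡ = trans (G≡J (ℤ.suc x)) (cong J (suc-+ x u))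

QuasiPeriodic : ℕ → ℕ → (ℤ → ℤ) → Set
QuasiPeriodic m k J = ∀ x R → J (x + R * + m) ≡ J x + R * + k

Step-deck : ∀ {m k J} → QuasiPeriodic m k J → ∀ R {x y} →
            Step J x y ⇔ Step J (x + R * + m) (y + R * + k)
Step-deck {m} {k} {J} J-qp R = Step-translate {J} {J} (R * + m) (R * + k) (λ z → sym (J-qp z R))

module Staircase {J : ℤ → ℤ} (J-mono : ∀ {x y} → x ≤ y → J x ≤ J y) where

  Step-J : ∀ x → Step J x (J x)
  Step-J x = step ℤP.≤-refl (J-mono (ℤP.i≤suc[i] x))

  Step-pred-J : ∀ x → Step J (ℤ.pred x) (J x)
  Step-pred-J x = step (J-mono (ℤP.<⇒≤ (pred[i]<i x))) (ℤP.≤-reflexive (cong J (sym (ℤP.suc-pred x))))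

  Step-noncrossing : ∀ {a b c d} → Step J a b → Step J c d → ¬ LiftCross (bridge a b) (bridge c d)
  Step-noncrossing (step _ b≤) (step c≤ _) (inj₁ (a<c , d<b)) =
    ℤP.<⇒≱ d<b (ℤP.≤-trans b≤ (ℤP.≤-trans (J-mono (ℤP.i<j⇒suc[i]≤j a<c)) c≤))
  Step-noncrossing (step a≤ _) (step _ d≤) (inj₂ (c<a , b<d)) =
    ℤP.<⇒≱ b<d (ℤP.≤-trans d≤ (ℤP.≤-trans (J-mono (ℤP.i<j⇒suc[i]≤j c<a)) a≤))

  Step-maximal : ∀ {x y} → (∀ {c d} → Step J c d → ¬ LiftCross (bridge x y) (bridge c d)) → Step J x y
  Step-maximal {x} {y} avoids = step
    (ℤP.≮⇒≥ (λ y<Jx → avoids (Step-pred-J x) (inj₂ (pred[i]<i x , y<Jx))))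
    (ℤP.≮⇒≥ (λ J<y → avoids (Step-J (ℤ.suc x)) (inj₁ (i<suc[i] x , J<y))))

  Step-⊆⇒≗ : ∀ {J′} → (∀ {x y} → Step J x y → Step J′ x y) → J ≗ J′
  Step-⊆⇒≗ {J′} ⊆ x = ℤP.≤-antisym
    (subst (J x ≤_) (cong J′ (ℤP.suc-pred x)) (Step.upper (⊆ (Step-pred-J x))))
    (Step.lower (⊆ (Step-J x)))

  Step-ivt : ∀ n {a y} → J a ≤ y → y ≤ J (a + + n) → ∃[ x ] Step J x y
  Step-ivt zero {a} Ja≤y y≤J =
    a , step Ja≤y (ℤP.≤-trans (subst (_ ≤_) (cong J (ℤP.+-identityʳ a)) y≤J) (J-mono (ℤP.i≤suc[i] a)))
  Step-ivt (suc n) {a} {y} Ja≤y y≤J with y ℤP.≤? J (ℤ.suc a)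
  ... | yes y≤ = a , step Ja≤y y≤
  ... | no  y≰ = Step-ivt n (ℤP.<⇒≤ (ℤP.≰⇒> y≰))
    (subst (λ w → y ≤ J w) (solve 2 (λ a n → a :+ (con 1ℤ :+ n) := (con 1ℤ :+ a) :+ n) refl a (+ n)) y≤J)

-- Lifts of arcs to the strip

bridging-view : ∀ {γ} → IsBridging γ → ∃₂ λ a b → γ ≡ bridge a b
bridging-view {bridge a b} _ = a , b , refl

bridging⇒arc : ∀ {m k γ} → IsBridging γ → IsArc m k γ
bridging⇒arc {γ = bridge _ _} _ = tt

bridge-injective : ∀ {a b c d} → bridge a b ≡ bridge c d → a ≡ c × b ≡ d
bridge-injective refl = refl , refl

LiftCross-shift : ∀ {a b c d} s t → LiftCross (bridge a b) (bridge c d) →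
                  LiftCross (bridge (a + s) (b + t)) (bridge (c + s) (d + t))
LiftCross-shift s t (inj₁ (a<c , d<b)) = inj₁ (ℤP.+-monoˡ-< s a<c , ℤP.+-monoˡ-< t d<b)
LiftCross-shift s t (inj₂ (c<a , b<d)) = inj₂ (ℤP.+-monoˡ-< s c<a , ℤP.+-monoˡ-< t b<d)

record Lift (m k : ℕ) (T : List Arc) (x y : ℤ) : Set where
  constructor lift
  field
    offset  : ℤ
    lifted∈ : bridge (x + offset * + m) (y + offset * + k) ∈ T

module _ {m k : ℕ} {T : List Arc} where

  any⇒lift : ∀ {x y} → Any (SameArc m k (bridge x y)) T → Lift m k T x y
  any⇒lift p with find p
  ... | _ , γ∈ , r , refl = lift r γ∈

  lift⇒any : ∀ {x y} → Lift m k T x y → Any (SameArc m k (bridge x y)) T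
  lift⇒any (lift r γ∈) = lose γ∈ (r , refl)

  ∈⇒lift : ∀ {x y} → bridge x y ∈ T → Lift m k T x y
  ∈⇒lift {x} {y} γ∈ =
    lift 0ℤ (subst₂ (λ x′ y′ → bridge x′ y′ ∈ T)
                    (sym (ℤP.+-identityʳ x)) (sym (ℤP.+-identityʳ y)) γ∈)

  lift-deck : ∀ R {x y} → Lift m k T x y → Lift m k T (x + R * + m) (y + R * + k)
  lift-deck R {x} {y} (lift r γ∈) =
    lift (r - R) (subst₂ (λ x′ y′ → bridge x′ y′ ∈ T)
                         (sym (regroup x (+ m))) (sym (regroup y (+ k))) γ∈)
    where
    regroup : ∀ a N → a + R * N + (r - R) * N ≡ a + r * N
    regroup a N = solve 4 (λ a N r R → a :+ R :* N :+ (r :- R) :* N := a :+ r :* N) refl a N r R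

  lift-avoids : ∀ {γ} → (∀ {δ} → δ ∈ T → ¬ Cross m k γ δ) →
                ∀ {x y} → Lift m k T x y → ¬ LiftCross γ (bridge x y)
  lift-avoids {γ} avoid {x} {y} (lift r δ∈) cr =
    avoid δ∈ (- r , subst (LiftCross γ) (sym (cong₂ bridge (undeck x (+ m)) (undeck y (+ k)))) cr)
    where
    undeck : ∀ a N → a + r * N + - r * N ≡ a
    undeck a N = solve 3 (λ a r N → a :+ r :* N :+ (:- r) :* N := a) refl a r N

  lifts-noncrossing : IsTriangulation m k T → ∀ {a b c d} →
                      Lift m k T a b → Lift m k T c d → ¬ LiftCross (bridge a b) (bridge c d)
  lifts-noncrossing (_ , noncrossing , _) (lift r γ∈) l cr =
    lift-avoids (noncrossing γ∈) (lift-deck r l) (LiftCross-shift (r * + m) (r * + k) cr)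

  lifts-maximal : IsTriangulation m k T → All IsBridging T → ∀ {x y} →
                  (∀ {c d} → Lift m k T c d → ¬ LiftCross (bridge x y) (bridge c d)) → Lift m k T x y
  lifts-maximal (_ , _ , maximal) bridging {x} {y} avoids = any⇒lift (maximal (bridge x y) tt avoid)
    where
    avoid : ∀ {δ} → δ ∈ T → ¬ Cross m k (bridge x y) δ
    avoid {bridge c d} δ∈ (ρ , cr) = avoids (lift-deck ρ (∈⇒lift δ∈)) cr
    avoid {outerP _ _} δ∈ = ⊥-elim (All.lookup bridging δ∈)
    avoid {innerP _ _} δ∈ = ⊥-elim (All.lookup bridging δ∈)

  lift? : .{{NonZero m}} → ∀ x y → Dec (Lift m k T x y)
  lift? x y = map′ any⇒lift lift⇒any (Any.any? (sameArc? x y) T)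
    where
    sameArc? : ∀ x y δ → Dec (SameArc m k (bridge x y) δ)
    sameArc? x y (bridge c d) = map′ (λ (e₁ , e₂) → R , cong₂ bridge e₁ e₂) offset-is-R
                                     ((x + R * + m) ℤ.≟ c ×-dec (y + R * + k) ℤ.≟ d)
      where
      R : ℤ
      R = (c - x) /ℕ m
      offset-is-R : SameArc m k (bridge x y) (bridge c d) → (x + R * + m ≡ c) × (y + R * + k ≡ d)
      offset-is-R (r , refl) rewrite deck-offset-unique m x r = refl , refl
    sameArc? x y (outerP _ _) = no λ ()
    sameArc? x y (innerP _ _) = no λ ()

lift-nonempty : ∀ {m k T} → IsTriangulation m k T → All IsBridging T → ∃₂ λ x y → Lift m k T x y
lift-nonempty {T = []} (_ , _ , maximal) _ with maximal (bridge 0ℤ 0ℤ) tt (λ ())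
... | ()
lift-nonempty {T = bridge x y ∷ _} _ _ = x , y , ∈⇒lift (here refl)
lift-nonempty {T = outerP _ _ ∷ _} _ (() ∷ _)
lift-nonempty {T = innerP _ _ ∷ _} _ (() ∷ _)

module _ {m k : ℕ} {T T′ : List Arc} where

  ≅⇒lift-translation : T ≅[ m , k ] T′ →
                       ∃₂ λ s t → ∀ {a b} → Lift m k T′ a b → Lift m k T (a + s) (b + t)
  ≅⇒lift-translation (s , t , _ , back) = - s , - t , translate
    where
    translate : ∀ {a b} → Lift m k T′ a b → Lift m k T (a - s) (b - t)
    translate {a} {b} (lift r δ∈) with find (back δ∈)
    ... | bridge c d , γ∈ , ρ , eq =
      lift (r - ρ) (subst₂ (λ c′ d′ → bridge c′ d′ ∈ T)
                           (sym (untranslate a c s (+ m) (proj₁ (bridge-injective eq))))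
                           (sym (untranslate b d t (+ k) (proj₂ (bridge-injective eq)))) γ∈)
      where
      untranslate : ∀ a c s N → c + s + ρ * N ≡ a + r * N → a - s + (r - ρ) * N ≡ c
      untranslate a c s N e = begin
        a - s + (r - ρ) * N        ≡⟨ solve 5 (λ a s r ρ N → a :- s :+ (r :- ρ) :* N
                                                           := a :+ r :* N :- s :- ρ :* N) refl a s r ρ N ⟩
        a + r * N - s - ρ * N      ≡⟨ cong (λ w → w - s - ρ * N) (sym e) ⟩
        c + s + ρ * N - s - ρ * N  ≡⟨ solve 4 (λ c s ρ N → c :+ s :+ ρ :* N :- s :- ρ :* N := c)
                                              refl c s ρ N ⟩
        c                          ∎
        where open ≡-Reasoning

  lift-translation⇒≅ : All IsBridging T → All IsBridging T′ → ∀ s t →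
                       (∀ {a b} → Lift m k T′ a b ⇔ Lift m k T (a + s) (b + t)) → T ≅[ m , k ] T′
  lift-translation⇒≅ bridging bridging′ s t T′≈T = - s , - t , forth , back
    where
    forth : ∀ {γ} → γ ∈ T → Any (SameArc m k (shift (- s) (- t) γ)) T′
    forth {bridge a b} γ∈ = lift⇒any (Equivalence.from (T′≈T {a - s} {b - t})
      (subst₂ (Lift m k T) (sym (i-j+j≡i a s)) (sym (i-j+j≡i b t)) (∈⇒lift γ∈)))
    forth {outerP _ _} γ∈ = ⊥-elim (All.lookup bridging γ∈)
    forth {innerP _ _} γ∈ = ⊥-elim (All.lookup bridging γ∈)

    back : ∀ {δ} → δ ∈ T′ → Any (λ γ → SameArc m k (shift (- s) (- t) γ) δ) T
    back {bridge a b} δ∈ with Equivalence.to (T′≈T {a} {b}) (∈⇒lift δ∈)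
    ... | lift r γ∈ = lose γ∈ (- r , cong₂ bridge (undo a s (+ m)) (undo b t (+ k)))
      where
      undo : ∀ a s N → a + s + r * N - s + - r * N ≡ a
      undo a s N = solve 4 (λ a s r N → a :+ s :+ r :* N :- s :+ (:- r) :* N := a) refl a s r N
    back {outerP _ _} δ∈ = ⊥-elim (All.lookup bridging′ δ∈)
    back {innerP _ _} δ∈ = ⊥-elim (All.lookup bridging′ δ∈)

-- The staircase triangulation of a list of increments

InStairs : List ℕ → ℕ × ℕ → Set
InStairs L (i , j) = prefixSum L i ℕ.≤ j × j ℕ.≤ prefixSum L (suc i)

inStairs? : ∀ L → Decidable (InStairs L)
inStairs? L (i , j) = prefixSum L i ℕP.≤? j ×-dec j ℕP.≤? prefixSum L (suc i)

bridgeℕ : ℕ × ℕ → Arc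
bridgeℕ (i , j) = bridge (+ i) (+ j)

stairs : List ℕ → List Arc
stairs L = map bridgeℕ (filter (inStairs? L) (cartesianProduct (upTo (length L)) (upTo (suc (sum L)))))

∈-stairs⁻ : ∀ {L γ} → γ ∈ stairs L →
            ∃₂ λ i j → γ ≡ bridge (+ i) (+ j) × i ℕ.< length L × InStairs L (i , j)
∈-stairs⁻ {L} γ∈ with ∈.∈-map⁻ bridgeℕ γ∈
... | (i , j) , ij∈ , refl with ∈.∈-filter⁻ (inStairs? L) ij∈
...   | ij∈ᴾ , cell =
  i , j , refl , ∈.∈-upTo⁻ (proj₁ (∈.∈-cartesianProduct⁻ (upTo (length L)) _ ij∈ᴾ)) , cell

∈-stairs⁺ : ∀ {L i j} → i ℕ.< length L → InStairs L (i , j) → bridge (+ i) (+ j) ∈ stairs L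
∈-stairs⁺ {L} {i} {j} i<m cell@(_ , j≤) = ∈.∈-map⁺ bridgeℕ (∈.∈-filter⁺ (inStairs? L)
  (∈.∈-cartesianProduct⁺ (∈.∈-upTo⁺ i<m) (∈.∈-upTo⁺ (s≤s j≤sum))) cell)
  where
  j≤sum : j ℕ.≤ sum L
  j≤sum = ℕP.≤-trans j≤ (subst (prefixSum L (suc i) ℕ.≤_) (prefixSum-length L) (prefixSum-mono L i<m))

stairs-bridging : ∀ L → All IsBridging (stairs L)
stairs-bridging L = All.tabulate bridging
  where
  bridging : ∀ {γ} → γ ∈ stairs L → IsBridging γ
  bridging γ∈ with ∈-stairs⁻ {L} γ∈
  ... | _ , _ , refl , _ = tt

staircase : (m k : ℕ) .{{_ : NonZero m}} → List ℕ → ℤ → ℤ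
staircase m k L x = + prefixSum L (x %ℕ m) + (x /ℕ m) * + k

module StaircaseOf {m k : ℕ} .{{_ : NonZero m}} (L : List ℕ) (len : length L ≡ m) (total : sum L ≡ k)
  where

  private
    J : ℤ → ℤ
    J = staircase m k L

    prefixSum-m : prefixSum L m ≡ k
    prefixSum-m = trans (cong (prefixSum L) (sym len)) (trans (prefixSum-length L) total)

  staircase-decompose : ∀ {i} R → i ℕ.≤ m → J (+ i + R * + m) ≡ + prefixSum L i + R * + k
  staircase-decompose {i} R i≤m with ℕP.m≤n⇒m<n∨m≡n i≤m
  ... | inj₁ i<m with %ℕ-/ℕ-unique m {i} {R} (+ i + R * + m) i<m refl
  ...   | i≡ , R≡ = cong₂ (λ i′ R′ → + prefixSum L i′ + R′ * + k) i≡ R≡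
  staircase-decompose {i} R i≤m | inj₂ refl
    with %ℕ-/ℕ-unique m {0} {1ℤ + R} (+ m + R * + m) (ℕ.>-nonZero⁻¹ m)
           (solve 2 (λ m R → m :+ R :* m := con 0ℤ :+ (con 1ℤ :+ R) :* m) refl (+ m) R)
  ... | 0≡ , R≡ = begin
    J (+ m + R * + m)          ≡⟨ cong₂ (λ i′ R′ → + prefixSum L i′ + R′ * + k) 0≡ R≡ ⟩
    + 0 + (1ℤ + R) * + k       ≡⟨ solve 2 (λ k R → con 0ℤ :+ (con 1ℤ :+ R) :* k := k :+ R :* k)
                                           refl (+ k) R ⟩
    + k + R * + k              ≡⟨ cong (λ w → + w + R * + k) prefixSum-m ⟨
    + prefixSum L m + R * + k  ∎
    where open ≡-Reasoning

  staircase-at : ∀ {i} → i ℕ.≤ m → J (+ i) ≡ + prefixSum L i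
  staircase-at {i} i≤m =
    trans (cong J (sym (ℤP.+-identityʳ (+ i)))) (trans (staircase-decompose 0ℤ i≤m) (ℤP.+-identityʳ _))

  staircase-quasiPeriodic : QuasiPeriodic m k J
  staircase-quasiPeriodic x R = begin
    J (x + R * + m)                              ≡⟨ cong J regroup ⟩
    J (+ (x %ℕ m) + (x /ℕ m + R) * + m)          ≡⟨ staircase-decompose (x /ℕ m + R)
                                                                        (ℕP.<⇒≤ (n%ℕd<d x m)) ⟩
    + prefixSum L (x %ℕ m) + (x /ℕ m + R) * + k  ≡⟨ solve 4 (λ p q R k → p :+ (q :+ R) :* k := p :+ q :* k :+ R :* k)
                                                            refl (+ prefixSum L (x %ℕ m)) (x /ℕ m) R (+ k) ⟩
    J x + R * + k                                ∎
    where
    open ≡-Reasoning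
    regroup : x + R * + m ≡ + (x %ℕ m) + (x /ℕ m + R) * + m
    regroup = trans (cong (_+ R * + m) (a≡a%ℕn+[a/ℕn]*n x m))
      (solve 4 (λ i q R m → i :+ q :* m :+ R :* m := i :+ (q :+ R) :* m) refl (+ (x %ℕ m)) (x /ℕ m) R (+ m))

  staircase-mono : ∀ {x y} → x ≤ y → J x ≤ J y
  staircase-mono = stepwise-mono J J-step
    where
    J-step : ∀ x → J x ≤ J (ℤ.suc x)
    J-step x = begin
      J x                              ≡⟨⟩
      + prefixSum L i + q * + k        ≤⟨ ℤP.+-monoˡ-≤ (q * + k) (+≤+ (prefixSum-mono L (ℕP.n≤1+n i))) ⟩
      + prefixSum L (suc i) + q * + k  ≡⟨ staircase-decompose q (n%ℕd<d x m) ⟨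
      J (+ suc i + q * + m)            ≡⟨ cong J regroup ⟨
      J (ℤ.suc x)                      ∎
      where
      open ℤP.≤-Reasoning
      i = x %ℕ m
      q = x /ℕ m
      regroup : ℤ.suc x ≡ + suc i + q * + m
      regroup = trans (cong ℤ.suc (a≡a%ℕn+[a/ℕn]*n x m))
        (solve 2 (λ i t → con 1ℤ :+ (i :+ t) := (con 1ℤ :+ i) :+ t) refl (+ i) (q * + m))

  open Staircase staircase-mono

  InStairs⇔Step : ∀ {i j} → i ℕ.< m → InStairs L (i , j) ⇔ Step J (+ i) (+ j)
  InStairs⇔Step i<m = mk⇔
    (λ (lo , hi) → step (subst (_≤ + _) (sym (staircase-at (ℕP.<⇒≤ i<m))) (+≤+ lo))
                        (subst (+ _ ≤_) (sym (staircase-at i<m)) (+≤+ hi)))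
    (λ (step lo hi) → ℤP.drop‿+≤+ (subst (_≤ + _) (staircase-at (ℕP.<⇒≤ i<m)) lo) ,
                      ℤP.drop‿+≤+ (subst (+ _ ≤_) (staircase-at i<m) hi))

  lift-stairs⇔Step : ∀ {x y} → Lift m k (stairs L) x y ⇔ Step J x y
  lift-stairs⇔Step {x} {y} = mk⇔ to from
    where
    to : Lift m k (stairs L) x y → Step J x y
    to (lift r γ∈) with ∈-stairs⁻ γ∈
    ... | i , j , eq , i<len , cell = Equivalence.from (Step-deck staircase-quasiPeriodic r)
      (subst₂ (Step J) (sym (proj₁ (bridge-injective eq))) (sym (proj₂ (bridge-injective eq)))
              (Equivalence.to (InStairs⇔Step (subst (i ℕ.<_) len i<len)) cell))

    from : Step J x y → Lift m k (stairs L) x y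
    from s = lift (- R) (subst₂ (λ a b → bridge a b ∈ stairs L) (sym x-Rm≡i) j≡w
                                (∈-stairs⁺ (subst (i ℕ.<_) (sym len) i<m)
                                           (Equivalence.from (InStairs⇔Step i<m) sᵢ)))
      where
      i = x %ℕ m
      R = x /ℕ m
      i<m = n%ℕd<d x m
      w = y + - R * + k
      x-Rm≡i : x + - R * + m ≡ + i
      x-Rm≡i = trans (cong (λ x′ → x′ + - R * + m) (a≡a%ℕn+[a/ℕn]*n x m))
        (solve 3 (λ i R m → i :+ R :* m :+ (:- R) :* m := i) refl (+ i) R (+ m))
      sʷ : Step J (+ i) w
      sʷ = subst (λ a → Step J a w) x-Rm≡i (Equivalence.to (Step-deck staircase-quasiPeriodic (- R)) s)
      j≡w : + ℤ.∣ w ∣ ≡ w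
      j≡w = ℤP.0≤i⇒+∣i∣≡i
        (ℤP.≤-trans (+≤+ z≤n) (subst (_≤ w) (staircase-at (ℕP.<⇒≤ i<m)) (Step.lower sʷ)))
      sᵢ : Step J (+ i) (+ ℤ.∣ w ∣)
      sᵢ = subst (Step J (+ i)) (sym j≡w) sʷ

  staircase-covers : .{{NonZero k}} → ∀ y → ∃[ x ] Step J x y
  staircase-covers y = Step-ivt m {q * + m} lower upper
    where
    q = y /ℕ k
    lower : J (q * + m) ≤ y
    lower = begin
      J (q * + m)           ≡⟨ cong J (sym (ℤP.+-identityˡ (q * + m))) ⟩
      J (+ 0 + q * + m)     ≡⟨ staircase-decompose q z≤n ⟩
      + 0 + q * + k         ≤⟨ ℤP.+-monoˡ-≤ (q * + k) (+≤+ z≤n) ⟩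
      + (y %ℕ k) + q * + k  ≡⟨ a≡a%ℕn+[a/ℕn]*n y k ⟨
      y                     ∎
      where open ℤP.≤-Reasoning
    upper : y ≤ J (q * + m + + m)
    upper = begin
      y                          ≡⟨ a≡a%ℕn+[a/ℕn]*n y k ⟩
      + (y %ℕ k) + q * + k       ≤⟨ ℤP.+-monoˡ-≤ (q * + k) (+≤+ (ℕP.<⇒≤ (n%ℕd<d y k))) ⟩
      + k + q * + k              ≡⟨ cong (λ w → + w + q * + k) prefixSum-m ⟨
      + prefixSum L m + q * + k  ≡⟨ staircase-decompose q ℕP.≤-refl ⟨
      J (+ m + q * + m)          ≡⟨ cong J (ℤP.+-comm (+ m) (q * + m)) ⟩
      J (q * + m + + m)          ∎
      where open ℤP.≤-Reasoning

  stairs-skeletal : .{{NonZero k}} → IsSkeletalTriangulation m k (stairs L)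
  stairs-skeletal = (All.map bridging⇒arc (stairs-bridging L) , noncrossing , maximal) , stairs-bridging L
    where
    to : ∀ {x y} → Lift m k (stairs L) x y → Step J x y
    to = Equivalence.to lift-stairs⇔Step
    from : ∀ {x y} → Step J x y → Lift m k (stairs L) x y
    from = Equivalence.from lift-stairs⇔Step

    noncrossing : ∀ {γ δ} → γ ∈ stairs L → δ ∈ stairs L → ¬ Cross m k γ δ
    noncrossing γ∈ δ∈ (r , cr)
      with bridging-view (All.lookup (stairs-bridging L) γ∈) | bridging-view (All.lookup (stairs-bridging L) δ∈)
    ... | _ , _ , refl | _ , _ , refl =
      Step-noncrossing (to (∈⇒lift γ∈))
                       (Equivalence.to (Step-deck staircase-quasiPeriodic r) (to (∈⇒lift δ∈))) cr

    maximal : ∀ γ → IsArc m k γ → (∀ {δ} → δ ∈ stairs L → ¬ Cross m k γ δ) →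
              Any (SameArc m k γ) (stairs L)
    maximal (bridge x y) _ avoid = lift⇒any (from (Step-maximal (λ s → lift-avoids avoid (from s))))
    maximal (outerP a b) (a+2≤b , _) avoid =
      ⊥-elim (lift-avoids avoid (from (Step-J (ℤ.suc a))) (i<suc[i] a , i+2≤j⇒suc[i]<j {a} a+2≤b))
    maximal (innerP c d) (c+2≤d , _) avoid with staircase-covers (ℤ.suc c)
    ... | _ , s = ⊥-elim (lift-avoids avoid (from s) (i<suc[i] c , i+2≤j⇒suc[i]<j {c} c+2≤d))

module _ {m k : ℕ} .{{_ : NonZero m}} where

  quasiPeriodic-ext : ∀ {f g} → QuasiPeriodic m k f → QuasiPeriodic m k g →
                      (∀ {i} → i ℕ.< m → f (+ i) ≡ g (+ i)) → f ≗ g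
  quasiPeriodic-ext {f} {g} f-qp g-qp agree x = begin
    f x                              ≡⟨ cong f (a≡a%ℕn+[a/ℕn]*n x m) ⟩
    f (+ (x %ℕ m) + (x /ℕ m) * + m)  ≡⟨ f-qp (+ (x %ℕ m)) (x /ℕ m) ⟩
    f (+ (x %ℕ m)) + (x /ℕ m) * + k  ≡⟨ cong (_+ (x /ℕ m) * + k) (agree (n%ℕd<d x m)) ⟩
    g (+ (x %ℕ m)) + (x /ℕ m) * + k  ≡⟨ g-qp (+ (x %ℕ m)) (x /ℕ m) ⟨
    g (+ (x %ℕ m) + (x /ℕ m) * + m)  ≡⟨ cong g (a≡a%ℕn+[a/ℕn]*n x m) ⟨
    g x                              ∎
    where open ≡-Reasoning

  staircase-rotate₁ : ∀ {e L} → length (e ∷ L) ≡ m → sum (e ∷ L) ≡ k → ∀ x →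
    staircase m k (L ++ [ e ]) x + staircase m k (e ∷ L) 1ℤ ≡ staircase m k (e ∷ L) (x + 1ℤ)
  staircase-rotate₁ {e} {L} len total = quasiPeriodic-ext lhs-qp rhs-qp agree
    where
    J J′ : ℤ → ℤ
    J = staircase m k (e ∷ L)
    J′ = staircase m k (L ++ [ e ])
    module S = StaircaseOf (e ∷ L) len total
    module S′ = StaircaseOf (L ++ [ e ]) (trans (sym (↭-length (∷↭∷ʳ e L))) len)
                                          (trans (sym (sum-↭ (∷↭∷ʳ e L))) total)

    lhs-qp : QuasiPeriodic m k (λ x → J′ x + J 1ℤ)
    lhs-qp x R = trans (cong (_+ J 1ℤ) (S′.staircase-quasiPeriodic x R))
      (solve 3 (λ a b c → a :+ b :+ c := a :+ c :+ b) refl (J′ x) (R * + k) (J 1ℤ))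

    rhs-qp : QuasiPeriodic m k (λ x → J (x + 1ℤ))
    rhs-qp x R = trans (cong J (solve 3 (λ x a b → x :+ a :+ b := x :+ b :+ a) refl x (R * + m) 1ℤ))
                       (S.staircase-quasiPeriodic (x + 1ℤ) R)

    agree : ∀ {i} → i ℕ.< m → J′ (+ i) + J 1ℤ ≡ J (+ i + 1ℤ)
    agree {i} i<m = begin
      J′ (+ i) + J 1ℤ                           ≡⟨ cong₂ _+_ (S′.staircase-at (ℕP.<⇒≤ i<m))
                                                              (S.staircase-at (subst (1 ℕ.≤_) len (s≤s z≤n))) ⟩
      + (prefixSum (L ++ [ e ]) i ℕ.+ (e ℕ.+ 0)) ≡⟨ cong +_ (cong₂ ℕ._+_ (prefixSum-++ L [ e ] i≤len)
                                                                      (ℕP.+-identityʳ e)) ⟩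
      + (prefixSum L i ℕ.+ e)                   ≡⟨ cong +_ (ℕP.+-comm (prefixSum L i) e) ⟩
      + prefixSum (e ∷ L) (suc i)               ≡⟨ S.staircase-at i<m ⟨
      J (+ suc i)                               ≡⟨ cong J (ℤP.+-comm 1ℤ (+ i)) ⟩
      J (+ i + 1ℤ)                              ∎
      where
      open ≡-Reasoning
      i≤len : i ℕ.≤ length L
      i≤len = ℕ.s≤s⁻¹ (subst (i ℕ.<_) (sym len) i<m)

  staircase-rotate : ∀ {L} → length L ≡ m → sum L ≡ k → ∀ r x →
    staircase m k (rotate L r) x + staircase m k L (+ r) ≡ staircase m k L (x + + r)
  staircase-rotate {[]} len _ _ _ = ⊥-elim (ℕ.≢-nonZero⁻¹ m (sym len))
  staircase-rotate {e ∷ L} len total zero x = begin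
    J x + J (+ 0)  ≡⟨ cong (λ w → J x + w) (StaircaseOf.staircase-at (e ∷ L) len total z≤n) ⟩
    J x + + 0      ≡⟨ ℤP.+-identityʳ (J x) ⟩
    J x            ≡⟨ cong J (ℤP.+-identityʳ x) ⟨
    J (x + + 0)    ∎
    where
    open ≡-Reasoning
    J : ℤ → ℤ
    J = staircase m k (e ∷ L)
  staircase-rotate {e ∷ L} len total (suc r) x = begin
    J⟲ x + J (+ suc r)        ≡⟨ cong (λ w → J⟲ x + J w) (ℤP.+-comm 1ℤ (+ r)) ⟩
    J⟲ x + J (+ r + 1ℤ)       ≡⟨ cong (λ w → J⟲ x + w) (staircase-rotate₁ len total (+ r)) ⟨
    J⟲ x + (J′ (+ r) + J 1ℤ)  ≡⟨ ℤP.+-assoc (J⟲ x) (J′ (+ r)) (J 1ℤ) ⟨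
    J⟲ x + J′ (+ r) + J 1ℤ    ≡⟨ cong (_+ J 1ℤ) (staircase-rotate len′ total′ r x) ⟩
    J′ (x + + r) + J 1ℤ       ≡⟨ staircase-rotate₁ len total (x + + r) ⟩
    J (x + + r + 1ℤ)          ≡⟨ cong J (ℤP.+-assoc x (+ r) 1ℤ) ⟩
    J (x + (+ r + 1ℤ))        ≡⟨ cong (λ w → J (x + w)) (ℤP.+-comm (+ r) 1ℤ) ⟩
    J (x + + suc r)           ∎
    where
    open ≡-Reasoning
    J J′ J⟲ : ℤ → ℤ
    J = staircase m k (e ∷ L)
    J′ = staircase m k (L ++ [ e ])
    J⟲ = staircase m k (rotate (L ++ [ e ]) r)
    len′ : length (L ++ [ e ]) ≡ m
    len′ = trans (sym (↭-length (∷↭∷ʳ e L))) len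
    total′ : sum (L ++ [ e ]) ≡ k
    total′ = trans (sym (sum-↭ (∷↭∷ʳ e L))) total

  staircase-injective : ∀ {L L′} → length L ≡ m → length L′ ≡ m → sum L ≡ k → sum L′ ≡ k →
                        staircase m k L ≗ staircase m k L′ → L ≡ L′
  staircase-injective {L} {L′} len len′ total total′ J≗J′ =
    prefixSum-injective L L′ (trans len (sym len′)) λ i i≤len → ℤP.+-injective (begin
      + prefixSum L i         ≡⟨ S.staircase-at (subst (i ℕ.≤_) len i≤len) ⟨
      staircase m k L (+ i)   ≡⟨ J≗J′ (+ i) ⟩
      staircase m k L′ (+ i)  ≡⟨ S′.staircase-at (subst (i ℕ.≤_) len i≤len) ⟩
      + prefixSum L′ i        ∎)
    where
    open ≡-Reasoning
    module S = StaircaseOf L len total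
    module S′ = StaircaseOf L′ len′ total′

  translated-staircase⇒rotation : ∀ {L L′} → length L ≡ m → length L′ ≡ m → sum L ≡ k → sum L′ ≡ k →
    ∀ u v → (∀ z → staircase m k L′ z + v ≡ staircase m k L (z + u)) → L′ ≡ rotate L (u %ℕ m)
  translated-staircase⇒rotation {L} {L′} len len′ total total′ u v J′≈J =
    staircase-injective len′ (trans (↭-length (rotate-↭ L i₀)) len) total′
                        (trans (sum-↭ (rotate-↭ L i₀)) total)
      λ z → +-cancelʳ-≡ (J (+ i₀)) (begin
        J′ z + J (+ i₀)                           ≡⟨ +-cancelʳ-≡ (Q * + k)
                                                       (trans (ℤP.+-assoc (J′ z) (J (+ i₀)) (Q * + k)) (shifted z)) ⟩
        J (z + + i₀)                              ≡⟨ staircase-rotate len total i₀ z ⟨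
        staircase m k (rotate L i₀) z + J (+ i₀)  ∎)
    where
    open ≡-Reasoning
    module S = StaircaseOf L len total
    module S′ = StaircaseOf L′ len′ total′
    J J′ : ℤ → ℤ
    J = staircase m k L
    J′ = staircase m k L′
    i₀ = u %ℕ m
    Q = u /ℕ m
    J[+u] : ∀ z → J (z + u) ≡ J (z + + i₀) + Q * + k
    J[+u] z = trans
      (cong J (trans (cong (λ w → z + w) (a≡a%ℕn+[a/ℕn]*n u m)) (sym (ℤP.+-assoc z (+ i₀) (Q * + m)))))
      (S.staircase-quasiPeriodic (z + + i₀) Q)
    v≡ : v ≡ J (+ i₀) + Q * + k
    v≡ = begin
      v                        ≡⟨ ℤP.+-identityˡ v ⟨
      + 0 + v                  ≡⟨ cong (_+ v) (S′.staircase-at z≤n) ⟨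
      J′ 0ℤ + v                ≡⟨ J′≈J 0ℤ ⟩
      J (0ℤ + u)               ≡⟨ J[+u] 0ℤ ⟩
      J (0ℤ + + i₀) + Q * + k  ≡⟨ cong (λ w → J w + Q * + k) (ℤP.+-identityˡ (+ i₀)) ⟩
      J (+ i₀) + Q * + k       ∎
    shifted : ∀ z → J′ z + (J (+ i₀) + Q * + k) ≡ J (z + + i₀) + Q * + k
    shifted z = trans (cong (λ w → J′ z + w) (sym v≡)) (trans (J′≈J z) (J[+u] z))

  stairs-rotate-≅ : ∀ {L} → length L ≡ m → sum L ≡ k → ∀ r → stairs L ≅[ m , k ] stairs (rotate L r)
  stairs-rotate-≅ {L} len total r =
    lift-translation⇒≅ (stairs-bridging L) (stairs-bridging (rotate L r)) (+ r) (staircase m k L (+ r))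
      (⇔-trans S⟲.lift-stairs⇔Step
        (⇔-trans (Step-translate (+ r) (staircase m k L (+ r)) (staircase-rotate len total r))
                 (⇔-sym S.lift-stairs⇔Step)))
    where
    module S = StaircaseOf L len total
    module S⟲ = StaircaseOf (rotate L r) (trans (↭-length (rotate-↭ L r)) len)
                                          (trans (sum-↭ (rotate-↭ L r)) total)

  stairs-≅⇒rotation : ∀ {L L′} → length L ≡ m → length L′ ≡ m → sum L ≡ k → sum L′ ≡ k →
                      stairs L ≅[ m , k ] stairs L′ → ∃[ r ] rotate L r ≡ L′
  stairs-≅⇒rotation {L} {L′} len len′ total total′ T≅T′ with ≅⇒lift-translation T≅T′
  ... | s , t , translate = s %ℕ m , sym (translated-staircase⇒rotation len len′ total total′ s t J′≈J)
    where
    module S = StaircaseOf L len total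
    module S′ = StaircaseOf L′ len′ total′
    J J′ : ℤ → ℤ
    J = staircase m k L
    J′ = staircase m k L′
    J′≗ : J′ ≗ λ z → J (z + s) - t
    J′≗ = Staircase.Step-⊆⇒≗ S′.staircase-mono λ st →
      Equivalence.from (Step-translate s t (λ z → i-j+j≡i (J (z + s)) t))
        (Equivalence.to S.lift-stairs⇔Step (translate (Equivalence.from S′.lift-stairs⇔Step st)))
    J′≈J : ∀ z → J′ z + t ≡ J (z + s)
    J′≈J z = trans (cong (_+ t) (J′≗ z)) (i-j+j≡i (J (z + s)) t)

-- Maximal non-crossing deck-invariant sets of bridges

module MaximalBridgeSet {m k : ℕ} .{{_ : NonZero m}} (S : ℤ → ℤ → Set)
  (S-noncrossing : ∀ {a b c d} → S a b → S c d → ¬ LiftCross (bridge a b) (bridge c d))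
  (S-maximal : ∀ {x y} → (∀ {c d} → S c d → ¬ LiftCross (bridge x y) (bridge c d)) → S x y)
  (S-deck : ∀ R {x y} → S x y → S (x + R * + m) (y + R * + k))
  where

  private
    S-resp : ∀ {x x′ y y′} → x ≡ x′ → y ≡ y′ → S x y → S x′ y′
    S-resp = subst₂ S

    i<i+m : ∀ x → x < x + 1ℤ * + m
    i<i+m x = subst (_< x + 1ℤ * + m) (ℤP.+-identityʳ x)
      (ℤP.+-monoʳ-< x (subst (0ℤ <_) (sym (ℤP.*-identityˡ (+ m))) (+<+ (ℕ.>-nonZero⁻¹ m))))

    i-m<i : ∀ x → x + -1ℤ * + m < x
    i-m<i x = subst (x + -1ℤ * + m <_) (solve 2 (λ x m → x :+ con -1ℤ :* m :+ con 1ℤ :* m := x) refl x (+ m))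
                    (i<i+m (x + -1ℤ * + m))

  column-convex : ∀ {x a b y} → S x a → S x b → a ≤ y → y ≤ b → S x y
  column-convex sa sb a≤y y≤b = S-maximal λ where
    s (inj₁ (x<c , d<y)) → S-noncrossing sb s (inj₁ (x<c , ℤP.<-≤-trans d<y y≤b))
    s (inj₂ (c<x , y<d)) → S-noncrossing sa s (inj₂ (c<x , ℤP.≤-<-trans a≤y y<d))

  Corner : ℤ → ℤ → Set
  Corner x y = S (ℤ.pred x) y × S x y

  corner-unique : ∀ {x y y′} → Corner x y → Corner x y′ → y ≡ y′
  corner-unique {x} (s₋ , s) (t₋ , t) = ℤP.≤-antisym
    (ℤP.≮⇒≥ λ y′<y → S-noncrossing s₋ t (inj₁ (pred[i]<i x , y′<y)))
    (ℤP.≮⇒≥ λ y<y′ → S-noncrossing t₋ s (inj₁ (pred[i]<i x , y<y′)))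

  corner-deck : ∀ R {x y} → Corner x y → Corner (x + R * + m) (y + R * + k)
  corner-deck R {x} (s₋ , s) = S-resp (ℤP.pred-+ x (R * + m)) refl (S-deck R s₋) , S-deck R s

  corners⇒Step : ∀ {G} → (∀ z → Corner z (G z)) → ∀ {z w} → S z w ⇔ Step G z w
  corners⇒Step {G} corner {z} {w} = mk⇔
    (λ s → step (ℤP.≮⇒≥ λ w<G → S-noncrossing (proj₁ (corner z)) s (inj₁ (pred[i]<i z , w<G)))
                (ℤP.≮⇒≥ λ G<w → S-noncrossing s (proj₂ (corner (ℤ.suc z))) (inj₁ (i<suc[i] z , G<w))))
    (λ (step lo hi) → column-convex (proj₂ (corner z))
                                    (S-resp (ℤP.pred-suc z) refl (proj₁ (corner (ℤ.suc z)))) lo hi)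

  module _ (S? : ∀ x y → Dec (S x y)) where

    -- The lowest lift at x₀ is also a lift at x₀ - 1; the search for it starts at y₀ - k,
    -- below which the deck translate (x₀ - m, y₀ - k) of (x₀, y₀) leaves no room.
    corner-exists : ∀ {x₀ y₀} → S x₀ y₀ → ∃[ y ] Corner x₀ y
    corner-exists {x₀} {y₀} s₀ with least-witness (λ j → S? x₀ (y₀ - + k + + j))
                                                    (S-resp refl (sym (i-j+j≡i y₀ (+ k))) s₀)
    ... | j , sj , below = B + + j , S-maximal avoid , sj
      where
      B = y₀ - + k
      above-B : ∀ {d} → S x₀ d → B ≤ d
      above-B s = ℤP.≮⇒≥ λ d<B → S-noncrossing s
        (S-resp refl (solve 2 (λ y k → y :+ con -1ℤ :* k := y :- k) refl y₀ (+ k)) (S-deck -1ℤ s₀))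
        (inj₂ (i-m<i x₀ , d<B))
      avoid : ∀ {c d} → S c d → ¬ LiftCross (bridge (ℤ.pred x₀) (B + + j)) (bridge c d)
      avoid s (inj₂ (c<x₀-1 , y<d)) = S-noncrossing sj s (inj₂ (ℤP.<-trans c<x₀-1 (pred[i]<i x₀) , y<d))
      avoid {c} s (inj₁ (x₀-1<c , d<y)) with x₀ ℤP.<? c
      ... | yes x₀<c = S-noncrossing sj s (inj₁ (x₀<c , d<y))
      ... | no  x₀≮c with ℤP.≤-antisym (pred[i]<j⇒i≤j x₀-1<c) (ℤP.≮⇒≥ x₀≮c)
      ...   | refl with ≤⇒+ (above-B s)
      ...     | j′ , refl = below (ℕP.≰⇒> λ j≤j′ → ℤP.<⇒≱ d<y (ℤP.+-monoʳ-≤ B (+≤+ j≤j′))) s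

    -- The highest lift at x is also a lift at x + 1; it lies below the deck translate
    -- (x + m, y + k) of (x, y).
    corner-suc : ∀ {x y} → Corner x y → ∃[ e ] Corner (ℤ.suc x) (y + + e)
    corner-suc {x} {y} (_ , s)
      with last-before-failure (λ e → S? x (y + + e)) (S-resp refl (sym (ℤP.+-identityʳ y)) s) (suc k) bounded
      where
      bounded : ¬ S x (y + + suc k)
      bounded s′ = S-noncrossing s′ (S-deck 1ℤ s) (inj₁ (i<i+m x ,
        subst (_< y + + suc k) (cong (λ w → y + w) (sym (ℤP.*-identityˡ (+ k))))
              (ℤP.+-monoʳ-< y (+<+ ℕP.≤-refl))))
    ... | e , se , ¬se₊₁ = e , S-resp (sym (ℤP.pred-suc x)) refl se , S-maximal avoid
      where
      suc-e : ℤ.suc (y + + e) ≡ y + + suc e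
      suc-e = solve 2 (λ y e → con 1ℤ :+ (y :+ e) := y :+ (con 1ℤ :+ e)) refl y (+ e)
      avoid : ∀ {c d} → S c d → ¬ LiftCross (bridge (ℤ.suc x) (y + + e)) (bridge c d)
      avoid s′ (inj₁ (x+1<c , d<y)) = S-noncrossing se s′ (inj₁ (ℤP.<-trans (i<suc[i] x) x+1<c , d<y))
      avoid {c} {d} s′ (inj₂ (c<x+1 , y<d)) with c ℤP.<? x
      ... | yes c<x = S-noncrossing se s′ (inj₂ (c<x , y<d))
      ... | no  c≮x with ℤP.≤-antisym (i<suc[j]⇒i≤j c<x+1) (ℤP.≮⇒≥ c≮x)
      ...   | refl = ¬se₊₁ (column-convex se s′ (ℤP.≤-trans (ℤP.i≤suc[i] _) (ℤP.≤-reflexive suc-e))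
                                                (subst (_≤ d) suc-e (ℤP.i<j⇒suc[i]≤j y<d)))

    corner-walk : ∀ {x y} → Corner x y → ∀ n →
                  ∃[ es ] length es ≡ n × (∀ {i} → i ℕ.≤ n → Corner (x + + i) (y + + prefixSum es i))
    corner-walk {x} {y} c zero = [] , refl , λ where
      z≤n → subst₂ Corner (sym (ℤP.+-identityʳ x)) (sym (ℤP.+-identityʳ y)) c
    corner-walk {x} {y} c (suc n) with corner-suc c
    ... | e , c′ with corner-walk c′ n
    ...   | es , len , walk = e ∷ es , cong suc len , walk′
      where
      walk′ : ∀ {i} → i ℕ.≤ suc n → Corner (x + + i) (y + + prefixSum (e ∷ es) i)
      walk′ {zero}  _         = subst₂ Corner (sym (ℤP.+-identityʳ x)) (sym (ℤP.+-identityʳ y)) c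
      walk′ {suc i} (s≤s i≤n) =
        subst₂ Corner (solve 2 (λ x i → (con 1ℤ :+ x) :+ i := x :+ (con 1ℤ :+ i)) refl x (+ i))
                      (ℤP.+-assoc y (+ e) (+ prefixSum es i)) (walk i≤n)

    -- Walking m corners from one corner yields the increments of the staircase; the deck
    -- transformation closes the walk, which forces the increments to sum to k.
    staircase-of : ∀ {x₀ y₀} → S x₀ y₀ →
      ∃[ es ] length es ≡ m × sum es ≡ k ×
        ∃₂ λ u v → ∀ {z w} → S z w ⇔ Step (staircase m k es) (z + u) (w + v)
    staircase-of {x₀} s₀ with corner-exists s₀
    ... | y₀ , c₀ with corner-walk c₀ m
    ...   | es , len , walk =
      es , len , total , - x₀ , - y₀ , ⇔-trans (corners⇒Step corner) (Step-translate (- x₀) (- y₀) G-J)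
      where
      J : ℤ → ℤ
      J = staircase m k es

      total : sum es ≡ k
      total = begin
        sum es                    ≡⟨ prefixSum-length es ⟨
        prefixSum es (length es)  ≡⟨ cong (prefixSum es) len ⟩
        prefixSum es m            ≡⟨ ℤP.+-injective (+-cancelˡ-≡ y₀ (corner-unique (walk ℕP.≤-refl) c₀+m)) ⟩
        k                         ∎
        where
        open ≡-Reasoning
        c₀+m : Corner (x₀ + + m) (y₀ + + k)
        c₀+m = subst₂ (λ a b → Corner (x₀ + a) (y₀ + b)) (ℤP.*-identityˡ (+ m)) (ℤP.*-identityˡ (+ k))
                      (corner-deck 1ℤ c₀)

      G : ℤ → ℤ
      G z = y₀ + J (z - x₀)

      G-J : ∀ z → G z - y₀ ≡ J (z - x₀)
      G-J z = trans (cong (_- y₀) (ℤP.+-comm y₀ (J (z - x₀)))) (i+j-j≡i (J (z - x₀)) y₀)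

      corner : ∀ z → Corner z (G z)
      corner z = subst₂ Corner x≡z (ℤP.+-assoc y₀ (+ prefixSum es i) (R * + k))
                        (corner-deck R (walk (ℕP.<⇒≤ (n%ℕd<d (z - x₀) m))))
        where
        i = (z - x₀) %ℕ m
        R = (z - x₀) /ℕ m
        x≡z : x₀ + + i + R * + m ≡ z
        x≡z = begin
          x₀ + + i + R * + m    ≡⟨ ℤP.+-assoc x₀ (+ i) (R * + m) ⟩
          x₀ + (+ i + R * + m)  ≡⟨ cong (λ w → x₀ + w) (a≡a%ℕn+[a/ℕn]*n (z - x₀) m) ⟨
          x₀ + (z - x₀)         ≡⟨ ℤP.+-comm x₀ (z - x₀) ⟩
          z - x₀ + x₀           ≡⟨ i-j+j≡i z x₀ ⟩
          z                     ∎
          where open ≡-Reasoning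

skeletal⇒≅stairs : ∀ {m k T} .{{_ : NonZero m}} → IsSkeletalTriangulation m k T →
                   ∃[ L ] length L ≡ m × sum L ≡ k × stairs L ≅[ m , k ] T
skeletal⇒≅stairs {m} {k} {T} (tri , bridging) =
  let _ , _ , l₀ = lift-nonempty tri bridging
      L , len , total , u , v , T≈J = staircase-of lift? l₀
  in L , len , total , lift-translation⇒≅ (stairs-bridging L) bridging u v
                         (⇔-trans T≈J (⇔-sym (StaircaseOf.lift-stairs⇔Step L len total)))
  where
  open MaximalBridgeSet (Lift m k T) (lifts-noncrossing tri) (lifts-maximal tri bridging) (λ R → lift-deck R)

-- Friezes with entries at least 2

continuant : (ℤ → ℕ) → ℤ → ℕ → ℤ
continuant a i zero          = 0ℤ
continuant a i (suc zero)    = 1ℤ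
continuant a i (suc (suc d)) = + a (i + + d) * continuant a i (suc d) - continuant a i d

module _ (a : ℤ → ℕ) where

  private
    K = continuant a

  continuant-diamond : ∀ i e → K i (suc e) * K (ℤ.suc i) (suc e) - K i (suc (suc e)) * K (ℤ.suc i) e ≡ 1ℤ
  continuant-diamond i zero = solve 1 (λ x → con 1ℤ :* con 1ℤ :- x :* con 0ℤ := con 1ℤ) refl (K i 2)
  continuant-diamond i (suc e) = begin
    A₂ * (+ a (ℤ.suc i + + e) * B₁ - B₀) - (c * A₂ - A₁) * B₁
      ≡⟨ cong (λ j → A₂ * (+ a j * B₁ - B₀) - (c * A₂ - A₁) * B₁)
              (solve 2 (λ i e → (con 1ℤ :+ i) :+ e := i :+ (con 1ℤ :+ e)) refl i (+ e)) ⟩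
    A₂ * (c * B₁ - B₀) - (c * A₂ - A₁) * B₁
      ≡⟨ solve 5 (λ A₂ c B₁ B₀ A₁ → A₂ :* (c :* B₁ :- B₀) :- (c :* A₂ :- A₁) :* B₁ := A₁ :* B₁ :- A₂ :* B₀)
               refl A₂ c B₁ B₀ A₁ ⟩
    A₁ * B₁ - A₂ * B₀
      ≡⟨ continuant-diamond i e ⟩
    1ℤ ∎
    where
    open ≡-Reasoning
    A₁ = K i (suc e)
    A₂ = K i (suc (suc e))
    B₀ = K (ℤ.suc i) e
    B₁ = K (ℤ.suc i) (suc e)
    c = + a (i + + suc e)

  module _ (a≥2 : ∀ i → 2 ℕ.≤ a i) where

    continuant-increasing : ∀ i d → 0ℤ ≤ K i d × K i d < K i (suc d)
    continuant-increasing i zero = +≤+ z≤n , +<+ (s≤s z≤n)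
    continuant-increasing i (suc d) with continuant-increasing i d
    ... | 0≤K₀ , K₀<K₁ = 0≤K₁ , (begin-strict
      K i (suc d)                          ≡⟨ ℤP.+-identityʳ (K i (suc d)) ⟨
      K i (suc d) + 0ℤ                     <⟨ ℤP.+-monoʳ-< (K i (suc d)) (i<j⇒0<j-i K₀<K₁) ⟩
      K i (suc d) + (K i (suc d) - K i d)  ≡⟨ solve 2 (λ x y → x :+ (x :- y) := con (+ 2) :* x :- y)
                                                    refl (K i (suc d)) (K i d) ⟩
      + 2 * K i (suc d) - K i d            ≤⟨ ℤP.+-monoˡ-≤ (- K i d) (ℤP.*-monoʳ-≤-nonNeg (K i (suc d))
                                                {{ℤ.nonNegative 0≤K₁}} (+≤+ (a≥2 (i + + d)))) ⟩
      K i (suc (suc d))                    ∎)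
      where
      open ℤP.≤-Reasoning
      0≤K₁ : 0ℤ ≤ K i (suc d)
      0≤K₁ = ℤP.≤-trans 0≤K₀ (ℤP.<⇒≤ K₀<K₁)

    ≥2⇒infiniteFrieze : IsInfiniteFrieze a
    ≥2⇒infiniteFrieze =
      (λ i → ℕP.<-≤-trans (s≤s z≤n) (a≥2 i)) , K , (λ _ → refl) , (λ _ → refl) ,
      (λ i → trans (solve 1 (λ x → x :* con 1ℤ :- con 0ℤ := x) refl (+ a (i + + 0)))
                   (cong (λ j → + a j) (ℤP.+-identityʳ i))) ,
      continuant-diamond ,
      λ i d → let 0≤K , K<K′ = continuant-increasing i (suc d) in ℤP.≤-<-trans 0≤K K<K′

-- Skeletal quiddity sequences

nth∈ : ∀ {q l} → l ℕ.< length q → nth q l ∈ q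
nth∈ {_ ∷ _} {zero}  _         = here refl
nth∈ {_ ∷ _} {suc l} (s≤s l<n) = there (nth∈ l<n)

∈⇒nth : ∀ {q x} → x ∈ q → ∃[ l ] l ℕ.< length q × nth q l ≡ x
∈⇒nth (here refl) = 0 , s≤s z≤n , refl
∈⇒nth (there x∈) with ∈⇒nth x∈
... | l , l<n , eq = suc l , s≤s l<n , eq

periodicExt-∈ : ∀ q → 1 ℕ.≤ length q → ∀ i → periodicExt q i ∈ q
periodicExt-∈ (x ∷ xs) _ i = nth∈ (n%ℕd<d (i - + 1) (suc (length xs)))

∈⇒periodicExt : ∀ {q x} → x ∈ q → ∃[ i ] periodicExt q i ≡ x
∈⇒periodicExt {q@(_ ∷ _)} x∈ with ∈⇒nth x∈
... | l , l<n , eq = + suc l , trans (cong (nth q) (m<n⇒m%n≡m l<n)) eq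

skeletal⇒≥2 : ∀ {q} → IsSkeletalQuiddity q → All (2 ℕ.≤_) q
skeletal⇒≥2 {q} ((_ , positive , _) , ≢1 , _) =
  All.tabulate λ x∈ → ≥2 (All.lookup ≢1 x∈) (positive-entry x∈)
  where
  positive-entry : ∀ {x} → x ∈ q → 0 ℕ.< x
  positive-entry x∈ with ∈⇒periodicExt x∈
  ... | i , refl = positive i
  ≥2 : ∀ {x} → x ≢ 1 → 0 ℕ.< x → 2 ℕ.≤ x
  ≥2 {suc zero}    ≢1 _ = ⊥-elim (≢1 refl)
  ≥2 {suc (suc _)} _  _ = s≤s (s≤s z≤n)

≥2⇒quiddity : ∀ {q} → 1 ℕ.≤ length q → All (2 ℕ.≤_) q → IsQuiddity q
≥2⇒quiddity {q} 1≤p ≥2 =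
  1≤p , ≥2⇒infiniteFrieze (periodicExt q) (λ i → All.lookup ≥2 (periodicExt-∈ q 1≤p i))

excess : List ℕ → List ℕ
excess = map (_∸ 2)

sumℤ-excess : ∀ {q} → All (2 ℕ.≤_) q → sumℤ (map (λ a → + a - + 2) q) ≡ + sum (excess q)
sumℤ-excess []                 = refl
sumℤ-excess {a ∷ _} (2≤a ∷ ≥2) = cong₂ _+_ (trans (ℤP.m-n≡m⊖n a 2) (ℤP.⊖-≥ 2≤a)) (sumℤ-excess ≥2)

excess-injective : ∀ {A B} → All (2 ℕ.≤_) A → All (2 ℕ.≤_) B → excess A ≡ excess B → A ≡ B
excess-injective {[]}    {[]}    _            _            _  = refl
excess-injective {a ∷ A} {b ∷ B} (2≤a ∷ ≥2ᴬ) (2≤b ∷ ≥2ᴮ) eq = cong₂ _∷_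
  (trans (sym (ℕP.m∸n+n≡m 2≤a)) (trans (cong (ℕ._+ 2) (List.∷-injectiveˡ eq)) (ℕP.m∸n+n≡m 2≤b)))
  (excess-injective ≥2ᴬ ≥2ᴮ (List.∷-injectiveʳ eq))

excess-2+ : ∀ L → excess (map (2 ℕ.+_) L) ≡ L
excess-2+ []      = refl
excess-2+ (e ∷ L) = cong (e ∷_) (excess-2+ L)

allTwo⇒excess-sum-0 : ∀ {q} → AllTwo q → sum (excess q) ≡ 0
allTwo⇒excess-sum-0 []          = refl
allTwo⇒excess-sum-0 (refl ∷ =2) = allTwo⇒excess-sum-0 =2

-- The bijection

module _ (n : ℕ) where

  excess-sum : ∀ {q} → All (2 ℕ.≤_) q → + n ≡ + length q + sumℤ (map (λ a → + a - + 2) q) →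
               sum (excess q) ≡ n ∸ length q
  excess-sum {q} ≥2 n≡ = sym (trans
    (cong (_∸ length q) (ℤP.+-injective (trans n≡ (cong (λ s → + length q + s) (sumℤ-excess ≥2)))))
    (ℕP.m+n∸m≡n (length q) (sum (excess q))))

  fromExcess : ∀ {m} L → length L ≡ m → 1 ℕ.≤ m → m ℕ.< n → sum L ≡ n ∸ m → QuidSet n
  fromExcess {m} L len 1≤m m<n total =
    q , (≥2⇒quiddity 1≤p ≥2 , All.map (λ { (s≤s (s≤s _)) () }) ≥2 , not-all-two) , 1≤p , p<n , n≡
    where
    q = map (2 ℕ.+_) L
    p≡m : length q ≡ m
    p≡m = trans (List.length-map _ L) len
    1≤p = subst (1 ℕ.≤_) (sym p≡m) 1≤m
    p<n = subst (ℕ._< n) (sym p≡m) m<n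
    ≥2 : All (2 ℕ.≤_) q
    ≥2 = All.tabulate λ x∈ → case ∈.∈-map⁻ (2 ℕ.+_) x∈ of λ { (_ , _ , refl) → s≤s (s≤s z≤n) }
    excess≡ : sum (excess q) ≡ n ∸ m
    excess≡ = trans (cong sum (excess-2+ L)) total
    not-all-two : ¬ AllTwo q
    not-all-two =2 = ℕP.<⇒≢ (ℕP.m<n⇒0<n∸m m<n) (trans (sym (allTwo⇒excess-sum-0 =2)) excess≡)
    n≡ : + n ≡ + length q + sumℤ (map (λ a → + a - + 2) q)
    n≡ = sym (trans (cong₂ (λ p s → + p + s) p≡m (sumℤ-excess ≥2))
                    (cong +_ (trans (cong (m ℕ.+_) excess≡) (ℕP.m+[n∸m]≡n (ℕP.<⇒≤ m<n)))))

  toTriangulation : QuidSet n → TriSet n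
  toTriangulation (q , skel , 1≤p , p<n , n≡) =
    length q , 1≤p , p<n , stairs (excess q) ,
    StaircaseOf.stairs-skeletal {{ℕ.>-nonZero 1≤p}} (excess q) (List.length-map _ q)
      (excess-sum (skeletal⇒≥2 skel) n≡) {{ℕ.>-nonZero (ℕP.m<n⇒0<n∸m p<n)}}

  toTriangulation-respects : ∀ x y → x ≈Q y → toTriangulation x ≈T toTriangulation y
  toTriangulation-respects (q , skel , 1≤p , p<n , n≡) _ (r , refl) =
    sym (↭-length (rotate-↭ q r)) ,
    subst (λ L → stairs (excess q) ≅[ length q , n ∸ length q ] stairs L) (sym (rotate-map (_∸ 2) q r))
          (stairs-rotate-≅ {{ℕ.>-nonZero 1≤p}} {excess q} (List.length-map _ q)
                           (excess-sum (skeletal⇒≥2 skel) n≡) r)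

  toTriangulation-injective : ∀ x y → toTriangulation x ≈T toTriangulation y → x ≈Q y
  toTriangulation-injective (q , skel , 1≤p , _ , n≡) (q′ , skel′ , _ , _ , n≡′) (p≡p′ , T≅T′) =
    let r , rotated = stairs-≅⇒rotation {{ℕ.>-nonZero 1≤p}} {excess q} {excess q′}
                        (List.length-map _ q) (trans (List.length-map _ q′) (sym p≡p′))
                        (excess-sum ≥2 n≡) (trans (excess-sum ≥2′ n≡′) (cong (n ∸_) (sym p≡p′))) T≅T′
    in r , excess-injective (All-resp-↭ (↭-sym (rotate-↭ q r)) ≥2) ≥2′
                            (trans (rotate-map (_∸ 2) q r) rotated)
    where
    ≥2 = skeletal⇒≥2 skel
    ≥2′ = skeletal⇒≥2 skel′

  toTriangulation-surjective : ∀ z → ∃[ x ] toTriangulation x ≈T z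
  toTriangulation-surjective (m , 1≤m , m<n , T , skel) =
    let L , len , total , L≅T = skeletal⇒≅stairs {{ℕ.>-nonZero 1≤m}} skel
        p≡m = trans (List.length-map _ L) len
    in fromExcess L len 1≤m m<n total , p≡m ,
       subst (λ p → stairs (excess (map (2 ℕ.+_) L)) ≅[ p , n ∸ p ] T) (sym p≡m)
             (subst (λ L′ → stairs L′ ≅[ m , n ∸ m ] T) (sym (excess-2+ L)) L≅T)

corollary3p21 : (n : ℕ) → 2 ℕ.≤ n → BijectionUpTo (QuidSet n) (_≈Q_ {n}) (TriSet n) (_≈T_ {n})
corollary3p21 n _ =
  toTriangulation n , toTriangulation-respects n , toTriangulation-injective n , toTriangulation-surjective n
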